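{- Let $C$ be an $X$-neighbour transitive code in $H(m,q)$ with minimum distance $\delta\geq3$, such that $X_1^Q$ is $2$-transitive of almost simple type with non-abelian simple socle $T$, $K:=X\cap B\neq1$, and $\mathrm{soc}(K)$ is normal in $X$ and satisfies $\mathrm{soc}(K)=D_1\times\cdots\times D_\ell$, where $\mathcal{J}=\{J_1,\ldots,J_\ell\}$ is a partition of $M=\{1,\ldots,m\}$ and each $D_i$ is a full diagonal subgroup of $\prod_{j\in J_i}T$ (viewed as the subgroup of $B$ of elements whose entries outside $J_i$ are trivial). Let $x=h\sigma\in X$ and $i,j\in\{1,\ldots,\ell\}$. Then $x^{ -1}D_ix=D_j$ if and only if $J_i^\sigma=J_j$.
   Context: $H(m,q)$ is the Hamming graph on $Q^m$, $|Q|=q$; $\mathrm{Aut}(H(m,q))=B\rtimes L$, $B=S_q^m$, $L\cong S_m$, acting by $\alpha^{(h_1,\ldots,h_m)}=(\alpha_1^{h_1},\ldots,\alpha_m^{h_m})$, $\alpha^\sigma=(\alpha_{1\sigma^{ -1}},\ldots,\alpha_{m\sigma^{ -1}})$; elements written $h\sigma$ with $h\in B,\sigma\in L$. For a code $C$, $C_1$ is the set of vertices at distance exactly $1$ from $C$; $C$ is $X$-neighbour transitive if $C$ and $C_1$ are $X$-orbits. $X_1=\{h\sigma\in X:1^\sigma=1\}$, $X_1^Q=\{h_1:(h_1,\ldots,h_m)\sigma\in X_1\}$. $\mathrm{soc}(K)$ is the subgroup generated by the minimal normal subgroups of $K$. A full diagonal subgroup of $\prod_{j\in J}T$, $J=\{i_1,\ldots,i_k\}$,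 is a subgroup $\{(t,t^{\psi_{i_2}},\ldots,t^{\psi_{i_k}}):t\in T\}$ with $\psi_{i_s}\in\mathrm{Aut}(T)$. -}

module Defs where

open import Level using (Level; _⊔_) renaming (suc to lsuc; zero to lzero)
open import Data.Nat using (ℕ; zero; suc; _+_; _≤_)
open import Data.Fin using (Fin; zero; suc; _≟_)
open import Data.Vec using (Vec; []; _∷_; lookup; tabulate)
open import Data.Product using (Σ; ∃; _×_; _,_)
open import Data.Sum using (_⊎_)
open import Relation.Nullary using (¬_; yes; no; Dec)
open import Relation.Binary.PropositionalEquality using (_≡_; _≢_)
open import Function using (_∘_)

-- Permutations of Fin n (acting on the right: i ↦ to p i = i^p)

record Perm (n : ℕ) : Set where
  field
    to      : Fin n → Fin n
    from    : Fin n → Fin n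
    to-from : ∀ i → to (from i) ≡ i
    from-to : ∀ i → from (to i) ≡ i
open Perm public

_≈ₚ_ : ∀ {n} → Perm n → Perm n → Set
p ≈ₚ r = ∀ i → to p i ≡ to r i

idₚ : ∀ {n} → Perm n
idₚ = record { to = λ i → i ; from = λ i → i ; to-from = λ _ → _≡_.refl ; from-to = λ _ → _≡_.refl }

-- p ∘ₚ r : first p, then r   (i^(pr) = (i^p)^r)
_∘ₚ_ : ∀ {n} → Perm n → Perm n → Perm n
p ∘ₚ r = record
  { to = to r ∘ to p
  ; from = from p ∘ from r
  ; to-from = λ i → trans' (cong' (to r) (to-from p (from r i))) (to-from r i)
  ; from-to = λ i → trans' (cong' (from p) (from-to r (to p i))) (from-to p i)
  }
  where
  trans' : ∀ {A : Set} {a b c : A} → a ≡ b → b ≡ c → a ≡ c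
  trans' _≡_.refl q = q
  cong' : ∀ {A B : Set} (f : A → B) {a b : A} → a ≡ b → f a ≡ f b
  cong' f _≡_.refl = _≡_.refl

invₚ : ∀ {n} → Perm n → Perm n
invₚ p = record { to = from p ; from = to p ; to-from = from-to p ; from-to = to-from p }

-- Automorphisms of H(m,q): elements hσ with h ∈ B = S_q^m, σ ∈ L ≅ S_m

record Aut (m q : ℕ) : Set where
  constructor _⟪_⟫
  field
    hs : Fin m → Perm q
    σ  : Perm m
open Aut public

_≈ₐ_ : ∀ {m q} → Aut m q → Aut m q → Set
x ≈ₐ y = (∀ j → hs x j ≈ₚ hs y j) × (σ x ≈ₚ σ y)

_·ₐ_ : ∀ {m q} → Aut m q → Aut m q → Aut m q
x ·ₐ y = record { hs = λ j → hs x j ∘ₚ hs y (to (σ x) j) ; σ = σ x ∘ₚ σ y }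

1ₐ : ∀ {m q} → Aut m q
1ₐ = record { hs = λ _ → idₚ ; σ = idₚ }

invₐ : ∀ {m q} → Aut m q → Aut m q
invₐ x = record { hs = λ k → invₚ (hs x (from (σ x) k)) ; σ = invₚ (σ x) }

Vertex : ℕ → ℕ → Set
Vertex m q = Vec (Fin q) m

act : ∀ {m q} → Vertex m q → Aut m q → Vertex m q
act α x = tabulate λ i → to (hs x (from (σ x) i)) (lookup α (from (σ x) i))

InB : ∀ {m q} → Aut m q → Set
InB x = σ x ≈ₚ idₚ

dist : ∀ {m q} → Vertex m q → Vertex m q → ℕ
dist [] [] = 0
dist (a ∷ α) (b ∷ β) with a ≟ b
... | yes _ = dist α β
... | no  _ = suc (dist α β)

Code : ℕ → ℕ → Set₁
Code m q = Vertex m q → Set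

MinDist≥ : ∀ {m q} → Code m q → ℕ → Set
MinDist≥ C d =
  (∃ λ α → ∃ λ β → C α × C β × α ≢ β)
  × (∀ α β → C α → C β → α ≢ β → d ≤ dist α β)

C₁ : ∀ {m q} → Code m q → Code m q
C₁ C ν = (∃ λ α → C α × dist ν α ≡ 1) × (∀ α → C α → 1 ≤ dist ν α)

IsOrbit : ∀ {m q} → (Aut m q → Set) → (Vertex m q → Set) → Set
IsOrbit X S =
  (∃ λ α → S α)
  × (∀ α x → S α → X x → S (act α x))
  × (∀ α β → S α → S β → ∃ λ x → X x × act α x ≡ β)

NeighbourTransitive : ∀ {m q} → (Aut m q → Set) → Code m q → Set
NeighbourTransitive X C = IsOrbit X C × IsOrbit X (C₁ C)

record GrpOps : Set₁ where
  field
    Carrier : Set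
    _≈_     : Carrier → Carrier → Set
    _∙_     : Carrier → Carrier → Carrier
    ε       : Carrier
    _⁻¹     : Carrier → Carrier

PermOps : ℕ → GrpOps
PermOps q = record { Carrier = Perm q ; _≈_ = _≈ₚ_ ; _∙_ = _∘ₚ_ ; ε = idₚ ; _⁻¹ = invₚ }

AutOps : ℕ → ℕ → GrpOps
AutOps m q = record { Carrier = Aut m q ; _≈_ = _≈ₐ_ ; _∙_ = _·ₐ_ ; ε = 1ₐ ; _⁻¹ = invₐ }

module GroupTheory (G : GrpOps) where
  open GrpOps G

  Sub : ∀ ℓ → Set (lsuc ℓ)
  Sub ℓ = Carrier → Set ℓ

  _⊆_ : ∀ {a b} → Sub a → Sub b → Set (a ⊔ b)
  P ⊆ R = ∀ x → P x → R x

  _≐_ : ∀ {a b} → Sub a → Sub b → Set (a ⊔ b)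
  P ≐ R = (P ⊆ R) × (R ⊆ P)

  IsSubgroup : ∀ {a} → Sub a → Set a
  IsSubgroup H =
    H ε
    × (∀ x y → H x → H y → H (x ∙ y))
    × (∀ x → H x → H (x ⁻¹))
    × (∀ x y → x ≈ y → H x → H y)

  Trivial : ∀ {a} → Sub a → Set a
  Trivial H = ∀ x → H x → x ≈ ε

  NormalIn : ∀ {a b} → Sub a → Sub b → Set (a ⊔ b)
  NormalIn N H = IsSubgroup N × (N ⊆ H) × (∀ h n → H h → N n → N (((h ⁻¹) ∙ n) ∙ h))

  MinNormal : Sub lzero → Sub lzero → Set₁
  MinNormal H N =
    NormalIn N H × ¬ Trivial N
    × (∀ (M : Sub lzero) → NormalIn M H → M ⊆ N → Trivial M ⊎ (N ⊆ M))

  data Gen {a} (S : Sub a) : Carrier → Set a where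
    gen  : ∀ {x} → S x → Gen S x
    one  : Gen S ε
    mul  : ∀ {x y} → Gen S x → Gen S y → Gen S (x ∙ y)
    inv  : ∀ {x} → Gen S x → Gen S (x ⁻¹)
    resp : ∀ {x y} → x ≈ y → Gen S x → Gen S y

  Soc : Sub lzero → Sub (lsuc lzero)
  Soc H = Gen (λ x → Σ (Sub lzero) λ N → MinNormal H N × N x)

  IsSimple : Sub lzero → Set₁
  IsSimple H =
    IsSubgroup H × ¬ Trivial H
    × (∀ (N : Sub lzero) → NormalIn N H → Trivial N ⊎ (H ⊆ N))

  IsNonabelian : Sub lzero → Set
  IsNonabelian H = ∃ λ x → ∃ λ y → H x × H y × ¬ ((x ∙ y) ≈ (y ∙ x))

  AlmostSimpleWithSocle : Sub lzero → Sub lzero → Set₁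
  AlmostSimpleWithSocle H T = IsSubgroup H × (Soc H ≐ T) × IsSimple T × IsNonabelian T

  IsAutOf : Sub lzero → (Carrier → Carrier) → Set
  IsAutOf T f =
    (∀ t → T t → T (f t))
    × (∀ a b → a ≈ b → f a ≈ f b)
    × (∀ a b → T a → T b → f (a ∙ b) ≈ (f a ∙ f b))
    × (∀ a b → T a → T b → f a ≈ f b → a ≈ b)
    × (∀ b → T b → ∃ λ a → T a × f a ≈ b)

TwoTransitive : ∀ {q} → (Perm q → Set) → Set
TwoTransitive {q} G =
  GroupTheory.IsSubgroup (PermOps q) G
  × (∀ a b c d → a ≢ b → c ≢ d → ∃ λ g → G g × to g a ≡ c × to g b ≡ d)

-- X₁^Q, with the distinguished coordinate 1 ∈ M being Fin index zero
X₁^Q : ∀ {m q} → (Aut (suc m) q → Set) → Perm q → Set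
X₁^Q {m} {q} X g = ∃ λ x → X x × to (σ x) zero ≡ zero × hs x zero ≈ₚ g

K∩B : ∀ {m q} → (Aut m q → Set) → Aut m q → Set
K∩B X x = X x × InB x

-- Partitions of M = Fin m into blocks J_1,…,J_ℓ : J_i = { j | part j ≡ i }

IsPartition : ∀ {m ℓ} → (Fin m → Fin ℓ) → Set
IsPartition {m} {ℓ} part = ∀ (i : Fin ℓ) → ∃ λ (j : Fin m) → part j ≡ i

BlockImage : ∀ {m ℓ} → (Fin m → Fin ℓ) → Perm m → Fin ℓ → Fin ℓ → Set
BlockImage part s i k = ∀ j → (part j ≡ i → part (to s j) ≡ k) × (part (to s j) ≡ k → part j ≡ i)

-- D_i = { (t^{ψ_j})_{j ∈ J_i} : t ∈ T }, trivial outside J_i, as a subgroup of B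
Diag : ∀ {m q ℓ} → (Perm q → Set) → (Fin m → Perm q → Perm q) → (Fin m → Fin ℓ)
       → Fin ℓ → Aut m q → Set
Diag T ψ part i x =
  InB x × ∃ λ t → T t
    × (∀ j → (part j ≡ i → hs x j ≈ₚ ψ j t) × (¬ part j ≡ i → hs x j ≈ₚ idₚ))

restrict : ∀ {m q ℓ} → (Fin m → Fin ℓ) → Fin ℓ → Aut m q → Aut m q
restrict part i x = record { hs = λ j → pick (part j ≟ i) (hs x j) ; σ = idₚ }
  where
  pick : ∀ {P : Set} {q} → Dec P → Perm q → Perm q
  pick (yes _) p = p
  pick (no _)  _ = idₚ

ProdDiag : ∀ {m q ℓ} → (Perm q → Set) → (Fin m → Perm q → Perm q) → (Fin m → Fin ℓ)
           → Aut m q → Set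
ProdDiag T ψ part x = InB x × (∀ i → Diag T ψ part i (restrict part i x))

Conj : ∀ {m q} → (Aut m q → Set) → Aut m q → Aut m q → Set
Conj D x y = ∃ λ d → D d × y ≈ₐ ((invₐ x ·ₐ d) ·ₐ x)

-- x⁻¹ D_i x is again a diagonal factor only if σ maps J_i onto J_j: otherwise some
-- coordinate in which D_i is nontrivial is sent to a coordinate where D_j is trivial,
-- and since each ψ_l is an automorphism this forces T = 1. Conversely, conjugation by
-- x ∈ X preserves soc(K) = D_1 × ⋯ × D_ℓ, and if J_i^σ = J_j it moves the support of
-- D_i into J_j, so x⁻¹ D_i x ⊆ D_j; the same for x⁻¹ gives equality.
module Submission where

open import Defs
open import Level using (Level)
open import Data.Nat using (ℕ; suc)
open import Data.Fin using (Fin; _≟_)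
open import Data.Product using (∃; _×_; _,_; proj₁; proj₂)
open import Data.Empty using (⊥-elim)
open import Relation.Nullary using (¬_; yes; no)
open import Relation.Nullary.Decidable using (decidable-stable)
open import Relation.Binary.PropositionalEquality
  using (_≡_; _≗_; refl; sym; trans; cong; subst; module ≡-Reasoning)
open import Function.Bundles using (_⇔_; mk⇔; Equivalence)
open GroupTheory using (IsSubgroup; NormalIn; Soc; Trivial; _⊆_; _≐_; AlmostSimpleWithSocle; IsAutOf)

private
  variable
    a b : Level
    m q ℓ : ℕ

-- p ≈ₚ r unfolds to to p ≗ to r; stated for functions, these keep their implicit
-- arguments inferable (an implicit Perm would only have its to-field determined).
≗-sym : {f g : Fin q → Fin q} → f ≗ g → g ≗ f
≗-sym f≗g k = sym (f≗g k)

≗-trans : {f g h : Fin q → Fin q} → f ≗ g → g ≗ h → f ≗ h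
≗-trans f≗g g≗h k = trans (f≗g k) (g≗h k)

module _ {T : Perm q → Set} {f : Perm q → Perm q}
         (f-aut : IsAutOf (PermOps q) T f) (T-id : T idₚ) where

  aut-idₚ : f idₚ ≈ₚ idₚ
  aut-idₚ k = begin
    to g k                  ≡⟨ from-to g (to g k) ⟨
    from g (to g (to g k))  ≡⟨ cong (from g) (idempotent k) ⟨
    from g (to g k)         ≡⟨ from-to g k ⟩
    k                       ∎
    where
    open ≡-Reasoning
    g = f idₚ
    idempotent : g ≈ₚ (g ∘ₚ g)
    idempotent = proj₁ (proj₂ (proj₂ f-aut)) idₚ idₚ T-id T-id

  aut-kernel-full⇒Trivial : (∀ t → T t → f t ≈ₚ idₚ) → Trivial (PermOps q) T
  aut-kernel-full⇒Trivial kills t t∈T =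
    proj₁ (proj₂ (proj₂ (proj₂ f-aut))) t idₚ t∈T T-id
      (≗-trans (kills t t∈T) (≗-sym aut-idₚ))

-- h⁻¹ p h for the right action: first h⁻¹, then p, then h.
conjₚ : Perm q → Perm q → Perm q
conjₚ h p = (invₚ h ∘ₚ p) ∘ₚ h

conjₚ-≈idₚ⇔ : (h p : Perm q) → conjₚ h p ≈ₚ idₚ ⇔ p ≈ₚ idₚ
conjₚ-≈idₚ⇔ h p = mk⇔ cancel introduce
  where
  open ≡-Reasoning
  cancel : conjₚ h p ≈ₚ idₚ → p ≈ₚ idₚ
  cancel c k = begin
    to p k                                  ≡⟨ from-to h (to p k) ⟨
    from h (to h (to p k))                  ≡⟨ cong (λ r → from h (to h (to p r))) (from-to h k) ⟨
    from h (to h (to p (from h (to h k))))  ≡⟨ cong (from h) (c (to h k)) ⟩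
    from h (to h k)                         ≡⟨ from-to h k ⟩
    k                                       ∎
  introduce : p ≈ₚ idₚ → conjₚ h p ≈ₚ idₚ
  introduce p≈id k = trans (cong (to h) (p≈id (from h k))) (to-from h k)

conjₐ : Aut m q → Aut m q → Aut m q
conjₐ x d = (invₐ x ·ₐ d) ·ₐ x

conjₐ-InB : (x d : Aut m q) → InB d → InB (conjₐ x d)
conjₐ-InB x d d∈B k = trans (cong (to (σ x)) (d∈B _)) (to-from (σ x) k)

conjₐ-hs : (x d : Aut m q) → InB d → ∀ p →
           hs (conjₐ x d) p ≈ₚ conjₚ (hs x (from (σ x) p)) (hs d (from (σ x) p))
conjₐ-hs x d d∈B p k =
  cong (λ r → to (hs x r) (to (hs d p′) (from (hs x p′) k))) (d∈B p′)
  where p′ = from (σ x) p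

conjₐ-hs-≈idₚ⇔ : (x d : Aut m q) → InB d → ∀ p →
                 hs (conjₐ x d) p ≈ₚ idₚ ⇔ hs d (from (σ x) p) ≈ₚ idₚ
conjₐ-hs-≈idₚ⇔ x d d∈B p = mk⇔
  (λ c → Equivalence.to (conjₚ-≈idₚ⇔ h d′) (≗-trans (≗-sym (conjₐ-hs x d d∈B p)) c))
  (λ e → ≗-trans (conjₐ-hs x d d∈B p) (Equivalence.from (conjₚ-≈idₚ⇔ h d′) e))
  where
  h  = hs x (from (σ x) p)
  d′ = hs d (from (σ x) p)

conjₐ-cancel : (x e : Aut m q) → InB e → e ≈ₐ conjₐ x (conjₐ (invₐ x) e)
conjₐ-cancel x e e∈B = hs≈ , σ≈
  where
  d = conjₐ (invₐ x) e
  d∈B = conjₐ-InB (invₐ x) e e∈B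
  σ≈ : σ e ≈ₚ σ (conjₐ x d)
  σ≈ k = trans (e∈B k) (sym (conjₐ-InB x d d∈B k))
  hs≈ : ∀ p → hs e p ≈ₚ hs (conjₐ x d) p
  hs≈ p k = sym (begin
    to (hs (conjₐ x d) p) k                              ≡⟨ conjₐ-hs x d d∈B p k ⟩
    to h (to (hs d p′) (from h k))                       ≡⟨ cong (to h) (conjₐ-hs (invₐ x) e e∈B p′ (from h k)) ⟩
    to h (from h′ (to (hs e p″) (to h′ (from h k))))     ≡⟨ cong (λ g → to h (from g (to (hs e p″) (to g (from h k)))))
                                                               (cong (hs x) (from-to (σ x) p′)) ⟩
    to h (from h (to (hs e p″) (to h (from h k))))       ≡⟨ to-from h _ ⟩
    to (hs e p″) (to h (from h k))                       ≡⟨ cong (to (hs e p″)) (to-from h k) ⟩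
    to (hs e p″) k                                       ≡⟨ cong (λ r → to (hs e r) k) (to-from (σ x) p) ⟩
    to (hs e p) k                                        ∎)
    where
    open ≡-Reasoning
    p′ = from (σ x) p
    p″ = to (σ x) p′
    h  = hs x p′
    h′ = hs x (from (σ x) p″)

≐-normal⇒conj-closed : {X : Aut m q → Set a} {N : Aut m q → Set b} {P : Aut m q → Set}
  → NormalIn (AutOps m q) N X → _≐_ (AutOps m q) N P
  → ∀ {x} → X x → ∀ u → P u → P (conjₐ x u)
≐-normal⇒conj-closed (_ , _ , conj∈N) (N⊆P , P⊆N) x∈X u u∈P =
  N⊆P _ (conj∈N _ u x∈X (P⊆N u u∈P))

SupportedOn : (Fin m → Fin ℓ) → Fin ℓ → Aut m q → Set
SupportedOn part i z = ∀ l → ¬ part l ≡ i → hs z l ≈ₚ idₚ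

BlockImage-invₚ : {part : Fin m → Fin ℓ} {s : Perm m} {i k : Fin ℓ}
  → BlockImage part s i k → BlockImage part (invₚ s) k i
BlockImage-invₚ {part = part} {s} {k = k} img l =
  (λ l∈Jk → proj₂ (img (from s l)) (subst (λ r → part r ≡ k) (sym (to-from s l)) l∈Jk))
  , (λ l′∈Ji → subst (λ r → part r ≡ k) (to-from s l) (proj₁ (img (from s l)) l′∈Ji))

conjₐ-SupportedOn : {part : Fin m → Fin ℓ} (x d : Aut m q) {i k : Fin ℓ}
  → InB d → BlockImage part (σ x) i k → SupportedOn part i d → SupportedOn part k (conjₐ x d)
conjₐ-SupportedOn {part = part} x d {k = k} d∈B img d-supp p p∉Jk =
  Equivalence.from (conjₐ-hs-≈idₚ⇔ x d d∈B p) (d-supp (from (σ x) p) λ p′∈Ji →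
    p∉Jk (subst (λ r → part r ≡ k) (to-from (σ x) p) (proj₁ (img (from (σ x) p)) p′∈Ji)))

restrict-in : (part : Fin m → Fin ℓ) {i : Fin ℓ} (z : Aut m q) {l : Fin m}
  → part l ≡ i → hs (restrict part i z) l ≈ₚ hs z l
restrict-in part {i} z {l} l∈Ji with part l ≟ i
... | yes _   = λ _ → refl
... | no l∉Ji = ⊥-elim (l∉Ji l∈Ji)

restrict-SupportedOn : (part : Fin m → Fin ℓ) {i : Fin ℓ} (z : Aut m q)
  → SupportedOn part i (restrict part i z)
restrict-SupportedOn part {i} z l l∉Ji with part l ≟ i
... | yes l∈Ji = ⊥-elim (l∉Ji l∈Ji)
... | no _     = λ _ → refl

module _ (T : Perm q → Set) (ψ : Fin m → Perm q → Perm q) (part : Fin m → Fin ℓ) where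

  Diag⇒SupportedOn : ∀ {i} z → Diag T ψ part i z → SupportedOn part i z
  Diag⇒SupportedOn _ (_ , _ , _ , coords) l = proj₂ (coords l)

  Diag-resp : ∀ {i} y z → y ≈ₐ z → Diag T ψ part i z → Diag T ψ part i y
  Diag-resp _ _ (hs≈ , σ≈) (z∈B , t , t∈T , coords) =
    ≗-trans σ≈ z∈B , t , t∈T ,
    λ l → (λ l∈Ji → ≗-trans (hs≈ l) (proj₁ (coords l) l∈Ji))
        , (λ l∉Ji → ≗-trans (hs≈ l) (proj₂ (coords l) l∉Ji))

  restrict-Diag : ∀ {k t} z → T t → (∀ l → part l ≡ k → hs z l ≈ₚ ψ l t)
    → Diag T ψ part k (restrict part k z)
  restrict-Diag z t∈T agrees =
    (λ _ → refl) , _ , t∈T ,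
    λ l → (λ l∈Jk → ≗-trans (restrict-in part z l∈Jk) (agrees l l∈Jk))
        , restrict-SupportedOn part z l

  diagElem : Fin ℓ → Perm q → Aut m q
  diagElem i t = restrict part i ((λ l → ψ l t) ⟪ idₚ ⟫)

  diagElem-hs : ∀ {i t l} → part l ≡ i → hs (diagElem i t) l ≈ₚ ψ l t
  diagElem-hs {t = t} = restrict-in part ((λ l → ψ l t) ⟪ idₚ ⟫)

  diagElem∈Diag : ∀ {i t} → T t → Diag T ψ part i (diagElem i t)
  diagElem∈Diag {t = t} t∈T = restrict-Diag ((λ l → ψ l t) ⟪ idₚ ⟫) t∈T (λ _ _ _ → refl)

  Diag⊆ProdDiag : T idₚ → (∀ l → ψ l idₚ ≈ₚ idₚ)
    → ∀ {i} z → Diag T ψ part i z → ProdDiag T ψ part z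
  Diag⊆ProdDiag T-id ψ-id {i} z z∈Di@(z∈B , t , t∈T , coords) = z∈B , restriction
    where
    restriction : ∀ k → Diag T ψ part k (restrict part k z)
    restriction k with k ≟ i
    ... | yes refl = restrict-Diag z t∈T (λ l → proj₁ (coords l))
    ... | no k≢i   = restrict-Diag z T-id λ l l∈Jk →
      ≗-trans (Diag⇒SupportedOn z z∈Di l (λ l∈Ji → k≢i (trans (sym l∈Jk) l∈Ji))) (≗-sym (ψ-id l))

  ProdDiag∩SupportedOn⇒Diag : ∀ {j} z → ProdDiag T ψ part z → SupportedOn part j z
    → Diag T ψ part j z
  ProdDiag∩SupportedOn⇒Diag {j} z (z∈B , restrictions) supp with restrictions j
  ... | _ , t , t∈T , coords =
    z∈B , t , t∈T ,
    λ l → (λ l∈Jj → ≗-trans (≗-sym (restrict-in part z l∈Jj)) (proj₁ (coords l) l∈Jj))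
        , supp l

  conjₐ-Diag : T idₚ → (∀ l → ψ l idₚ ≈ₚ idₚ)
    → ∀ x → (∀ u → ProdDiag T ψ part u → ProdDiag T ψ part (conjₐ x u))
    → ∀ {i k} d → BlockImage part (σ x) i k → Diag T ψ part i d → Diag T ψ part k (conjₐ x d)
  conjₐ-Diag T-id ψ-id x closed d img d∈Di =
    ProdDiag∩SupportedOn⇒Diag (conjₐ x d) (closed d (Diag⊆ProdDiag T-id ψ-id d d∈Di))
      (conjₐ-SupportedOn x d (proj₁ d∈Di) img (Diag⇒SupportedOn d d∈Di))

  BlockImage⇒Conj≐Diag : T idₚ → (∀ l → ψ l idₚ ≈ₚ idₚ)
    → ∀ x → (∀ u → ProdDiag T ψ part u → ProdDiag T ψ part (conjₐ x u))
    → (∀ u → ProdDiag T ψ part u → ProdDiag T ψ part (conjₐ (invₐ x) u))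
    → ∀ {i j} → BlockImage part (σ x) i j
    → _≐_ (AutOps m q) (Conj (Diag T ψ part i) x) (Diag T ψ part j)
  BlockImage⇒Conj≐Diag T-id ψ-id x closed closed⁻¹ img =
    (λ { y (d , d∈Di , y≈) → Diag-resp y (conjₐ x d) y≈ (conjₐ-Diag T-id ψ-id x closed d img d∈Di) })
    , λ e e∈Dj → conjₐ (invₐ x) e
                , conjₐ-Diag T-id ψ-id (invₐ x) closed⁻¹ e (BlockImage-invₚ {s = σ x} img) e∈Dj
                , conjₐ-cancel x e (proj₁ e∈Dj)

  Conj⊆Diag⇒ψ-trivial : ∀ x {i j l}
    → _⊆_ (AutOps m q) (Conj (Diag T ψ part i) x) (Diag T ψ part j)
    → part l ≡ i → ¬ part (to (σ x) l) ≡ j → ∀ t → T t → ψ l t ≈ₚ idₚ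
  Conj⊆Diag⇒ψ-trivial x {i} {l = l} C⊆D l∈Ji lσ∉Jj t t∈T =
    ≗-trans (≗-sym (diagElem-hs l∈Ji))
      (subst (λ r → hs d r ≈ₚ idₚ) (from-to (σ x) l)
        (Equivalence.to (conjₐ-hs-≈idₚ⇔ x d (λ _ → refl) (to (σ x) l))
          (Diag⇒SupportedOn (conjₐ x d) (C⊆D (conjₐ x d) d^x∈Conj) _ lσ∉Jj)))
    where
    d = diagElem i t
    d^x∈Conj : Conj (Diag T ψ part i) x (conjₐ x d)
    d^x∈Conj = d , diagElem∈Diag t∈T , (λ _ _ → refl) , (λ _ → refl)

  Diag⊆Conj⇒ψ-trivial : ∀ x {i j l}
    → _⊆_ (AutOps m q) (Diag T ψ part j) (Conj (Diag T ψ part i) x)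
    → part (to (σ x) l) ≡ j → ¬ part l ≡ i → ∀ t → T t → ψ (to (σ x) l) t ≈ₚ idₚ
  Diag⊆Conj⇒ψ-trivial x {j = j} {l} D⊆C lσ∈Jj l∉Ji t t∈T
    with D⊆C (diagElem j t) (diagElem∈Diag t∈T)
  ... | d , d∈Di , (hs≈ , _) =
    ≗-trans (≗-sym (diagElem-hs lσ∈Jj))
      (≗-trans (hs≈ (to (σ x) l))
        (Equivalence.from (conjₐ-hs-≈idₚ⇔ x d (proj₁ d∈Di) (to (σ x) l))
          (subst (λ r → hs d r ≈ₚ idₚ) (sym (from-to (σ x) l)) (Diag⇒SupportedOn d d∈Di l l∉Ji))))

  Conj≐Diag⇒BlockImage : T idₚ → ¬ Trivial (PermOps q) T → (∀ l → IsAutOf (PermOps q) T (ψ l))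
    → ∀ x {i j} → _≐_ (AutOps m q) (Conj (Diag T ψ part i) x) (Diag T ψ part j)
    → BlockImage part (σ x) i j
  Conj≐Diag⇒BlockImage T-id T≠1 ψ-aut x {i} {j} (C⊆D , D⊆C) l =
    (λ l∈Ji → decidable-stable (part (to (σ x) l) ≟ j) λ lσ∉Jj →
       T≠1 (aut-kernel-full⇒Trivial (ψ-aut l) T-id (Conj⊆Diag⇒ψ-trivial x C⊆D l∈Ji lσ∉Jj)))
    , (λ lσ∈Jj → decidable-stable (part l ≟ i) λ l∉Ji →
       T≠1 (aut-kernel-full⇒Trivial (ψ-aut _) T-id (Diag⊆Conj⇒ψ-trivial x D⊆C lσ∈Jj l∉Ji)))

-- Only the nontriviality of T, the ψ_l being automorphisms of T and the normality of
-- soc(K) = D_1 × ⋯ × D_ℓ in X are used.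
lemma5p4 : ∀ {m q ℓ : ℕ}
    (X : Aut (suc m) q → Set) → IsSubgroup (AutOps (suc m) q) X
    → (C : Code (suc m) q) → NeighbourTransitive X C → MinDist≥ C 3
    → (T : Perm q → Set)
    → AlmostSimpleWithSocle (PermOps q) (X₁^Q X) T
    → TwoTransitive (X₁^Q X)
    → ¬ Trivial (AutOps (suc m) q) (K∩B X)
    → (part : Fin (suc m) → Fin ℓ) → IsPartition part
    → (ψ : Fin (suc m) → Perm q → Perm q)
    → (∀ j → IsAutOf (PermOps q) T (ψ j))
    → (∀ i → ∃ λ j₀ → part j₀ ≡ i × (∀ t → T t → ψ j₀ t ≈ₚ t))
    → NormalIn (AutOps (suc m) q) (Soc (AutOps (suc m) q) (K∩B X)) X
    → _≐_ (AutOps (suc m) q) (Soc (AutOps (suc m) q) (K∩B X)) (ProdDiag T ψ part)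
    → ∀ (x : Aut (suc m) q) → X x → ∀ (i j : Fin ℓ)
    → (_≐_ (AutOps (suc m) q) (Conj (Diag T ψ part i) x) (Diag T ψ part j))
      ⇔ BlockImage part (σ x) i j
lemma5p4 X (_ , _ , X-inv , _) _ _ _ T (_ , _ , ((T-id , _) , T≠1 , _) , _) _ _
         part _ ψ ψ-aut _ soc◁X soc≐prod x x∈X i j =
  mk⇔ (Conj≐Diag⇒BlockImage T ψ part T-id T≠1 ψ-aut x)
      (BlockImage⇒Conj≐Diag T ψ part T-id ψ-id x (closed x∈X) (closed (X-inv x x∈X)))
  where
  ψ-id : ∀ l → ψ l idₚ ≈ₚ idₚ
  ψ-id l = aut-idₚ {T = T} {f = ψ l} (ψ-aut l) T-id
  closed : ∀ {y} → X y → ∀ u → ProdDiag T ψ part u → ProdDiag T ψ part (conjₐ y u)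
  closed = ≐-normal⇒conj-closed soc◁X soc≐prod
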